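{- For $n\geq 4$ and any finite simple connected graph $G$ with $|V(G)|\geq 3$, $\gamma_{P,c}(G\,\square\,W_n)\leq 3\gamma_c(G)$.
   Context: Power domination: for $S\subseteq V(G)$, start with $M(S)=N[S]$ and repeatedly add a vertex $w$ whenever some $v\in M(S)$ has $w$ as its unique neighbour outside $M(S)$; $S$ is a connected power dominating set if the final $M(S)$ is the whole vertex set and $\langle S\rangle$ is connected; $\gamma_{P,c}$ denotes the minimum size of such a set. $\gamma_c(G)$ is the connected domination number. The Cartesian product $G\,\square\,H$ has vertex set $V(G)\times V(H)$, with $(a,b)\sim(x,y)$ iff either $a=x$ and $by\in E(H)$, or $b=y$ and $ax\in E(G)$. $W_n$ denotes the wheel graph (a cycle together with one additional vertex adjacent to all cycle vertices). -}

module Defs where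

open import Data.Nat using (ℕ; zero; suc; _*_; _∸_; _≡ᵇ_)
open import Data.Bool using (Bool; true; false; T; _∧_; _∨_; not)
open import Data.Fin using (Fin; toℕ; remQuot; _≟_)
open import Data.Fin.Subset using (Subset; _∈_; _∉_)
open import Data.Product using (_×_; proj₁; proj₂)
open import Relation.Nullary using (¬_)
open import Relation.Nullary.Decidable using (⌊_⌋)
open import Relation.Binary.PropositionalEquality using (_≡_)

record Graph : Set where
  field
    order : ℕ
    adj   : Fin order → Fin order → Bool

open Graph public

Adj : (G : Graph) → Fin (order G) → Fin (order G) → Set
Adj G u v = T (adj G u v)

-- simple: symmetric and irreflexive (no loops, no multi-edges by construction)
IsSimple : Graph → Set
IsSimple G = (∀ u v → Adj G u v → Adj G v u) × (∀ u → ¬ Adj G u u)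

data WalkIn (G : Graph) (P : Fin (order G) → Set) : Fin (order G) → Fin (order G) → Set where
  here : ∀ {u} → P u → WalkIn G P u u
  step : ∀ {u v w} → P u → Adj G u v → WalkIn G P v w → WalkIn G P u w

IsConnected : Graph → Set
IsConnected G = ∀ u v → WalkIn G (λ _ → Data.Unit.⊤) u v
  where import Data.Unit

InducedConnected : (G : Graph) → Subset (order G) → Set
InducedConnected G S =
  Data.Product.∃ (λ u → u ∈ S) × (∀ u v → u ∈ S → v ∈ S → WalkIn G (λ x → x ∈ S) u v)
  where import Data.Product

InClosedNbhd : (G : Graph) → Subset (order G) → Fin (order G) → Set
InClosedNbhd G S v = v ∈ S Data.Sum.⊎ Data.Product.∃ (λ u → u ∈ S × Adj G u v)
  where import Data.Sum
        import Data.Product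

IsDominating : (G : Graph) → Subset (order G) → Set
IsDominating G S = ∀ v → InClosedNbhd G S v

IsConnectedDominating : (G : Graph) → Subset (order G) → Set
IsConnectedDominating G S = IsDominating G S × InducedConnected G S

-- M(S): least set containing N[S] and closed under the propagation rule
-- (if u ∈ M and w is the only neighbour of u possibly outside M, add w).
data Monitored (G : Graph) (S : Subset (order G)) : Fin (order G) → Set where
  dom  : ∀ {v} → InClosedNbhd G S v → Monitored G S v
  prop : ∀ {u w} → Monitored G S u → Adj G u w →
         (∀ x → Adj G u x → ¬ x ≡ w → Monitored G S x) → Monitored G S w

IsPowerDominating : (G : Graph) → Subset (order G) → Set
IsPowerDominating G S = ∀ v → Monitored G S v

IsConnectedPowerDominating : (G : Graph) → Subset (order G) → Set
IsConnectedPowerDominating G S = IsPowerDominating G S × InducedConnected G S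

-- Cartesian product, vertex (a , b) encoded as combine a b : Fin (m * n)
_□_ : Graph → Graph → Graph
G □ H = record
  { order = order G * order H
  ; adj   = λ x y →
      let p = remQuot (order H) x
          q = remQuot (order H) y
      in (⌊ proj₁ p ≟ proj₁ q ⌋ ∧ adj H (proj₂ p) (proj₂ q))
         ∨ (⌊ proj₂ p ≟ proj₂ q ⌋ ∧ adj G (proj₁ p) (proj₁ q))
  }

-- Wheel W_n on n vertices: vertex 0 is the hub, vertices 1 … n-1 form a cycle.
wheelAdj : (n : ℕ) → Fin n → Fin n → Bool
wheelAdj n i j =
  not (a ≡ᵇ b) ∧
  ( (a ≡ᵇ 0) ∨ (b ≡ᵇ 0) ∨ (suc a ≡ᵇ b) ∨ (suc b ≡ᵇ a)
  ∨ ((a ≡ᵇ 1) ∧ (b ≡ᵇ (n ∸ 1))) ∨ ((b ≡ᵇ 1) ∧ (a ≡ᵇ (n ∸ 1))) )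
  where
    a = toℕ i
    b = toℕ j

Wheel : ℕ → Graph
Wheel n = record { order = n ; adj = wheelAdj n }

{-# OPTIONS --safe #-}
-- Take S = D × {hub, v₁, v₂}, three columns of G □ W_n over a connected dominating set D of G,
-- so |S| = 3|D|.  As D dominates G, N[S] already contains those three columns.  Once the
-- columns v₀, …, v_j (j ≥ 2) are monitored, every (g, v_j) has (g, v_{j+1}) as its only
-- neighbour outside them, so the forcing sweeps around the rim column by column.  ⟨S⟩ is
-- connected: each fibre {d} × {hub, v₁, v₂} is a star at the hub, and the hub column is a copy
-- of ⟨D⟩.
module Submission where

open import Defs
open import Data.Bool using (Bool; true; false; T; _∧_; _∨_; not)
open import Data.Fin as Fin using (Fin; toℕ; combine; remQuot; fromℕ<)
open import Data.Fin.Properties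
  using (combine-remQuot; remQuot-combine; toℕ-injective; toℕ<n; toℕ-fromℕ<)
open import Data.Fin.Subset using (Subset; ∣_∣; _∈_; ⊥)
open import Data.Fin.Subset.Properties using (∣⊥∣≡0)
open import Data.Nat using (ℕ; zero; suc; _+_; _*_; _≤_; _<_; _≡ᵇ_; z≤n; s≤s; _≤?_)
open import Data.Nat.Properties
  using ( ≡ᵇ⇒≡; ≡⇒≡ᵇ; suc-injective; ≤-refl; ≤-reflexive; ≤-antisym; ≤∧≢⇒<; ≰⇒>; <⇒≤
        ; n≤1+n; m≤n⇒m≤1+n; m<1+n⇒m≤n; *-comm)
open import Data.Product using (Σ; _×_; _,_; proj₁; proj₂)
open import Data.Sum using (_⊎_; inj₁; inj₂)
open import Data.Unit using (tt)
open import Data.Vec using ([]; _∷_; _++_; concat; map; lookup; here; there)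
open import Data.Vec.Properties
  using (lookup-concat; lookup-map; map-id; map-const; []=⇒lookup; lookup⇒[]=)
open import Relation.Nullary using (Dec; yes; no)
open import Relation.Nullary.Decidable using (⌊_⌋; fromWitness)
open import Relation.Binary.PropositionalEquality
  using (_≡_; _≢_; refl; sym; trans; cong; cong₂; subst; module ≡-Reasoning)

-- The Boolean arguments made explicit below cannot be inferred, since _∧_ and _∨_ are not injective.
∧-intro : ∀ {x y} → T x → T y → T (x ∧ y)
∧-intro {true} _ q = q

∧-elimʳ : ∀ x {y} → T (x ∧ y) → T y
∧-elimʳ true q = q

∨-introˡ : ∀ x {y} → T x → T (x ∨ y)
∨-introˡ true _ = tt

∨-introʳ : ∀ x {y} → T y → T (x ∨ y)
∨-introʳ true  _ = tt
∨-introʳ false q = q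

∨-elim : ∀ x {y} → T (x ∨ y) → T x ⊎ T y
∨-elim true  _ = inj₁ tt
∨-elim false q = inj₂ q

⌊⌋∧-elim : ∀ {a} {A : Set a} {y} (a? : Dec A) → T (⌊ a? ⌋ ∧ y) → A × T y
⌊⌋∧-elim (yes a) q = a , q

not[n≡ᵇ1+n] : ∀ n → T (not (n ≡ᵇ suc n))
not[n≡ᵇ1+n] zero    = tt
not[n≡ᵇ1+n] (suc n) = not[n≡ᵇ1+n] n

wheel-hub-adj : ∀ {n} (c : Fin n) → Adj (Wheel (suc n)) Fin.zero (Fin.suc c)
wheel-hub-adj c = tt

wheel-adj-hub : ∀ {n} (c : Fin n) → Adj (Wheel (suc n)) (Fin.suc c) Fin.zero
wheel-adj-hub c = tt

wheel-adj-suc : ∀ {n} (b c : Fin n) → toℕ c ≡ suc (toℕ b) → Adj (Wheel n) b c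
wheel-adj-suc Fin.zero    (Fin.suc Fin.zero) refl = tt
wheel-adj-suc (Fin.suc b) (Fin.suc c)        1+c≡2+b =
  ∧-intro (subst (λ m → T (not (toℕ b ≡ᵇ m))) (sym c≡1+b) (not[n≡ᵇ1+n] (toℕ b)))
          (∨-introˡ (suc (toℕ b) ≡ᵇ toℕ c) (≡⇒≡ᵇ _ _ (sym c≡1+b)))
  where
    c≡1+b : toℕ c ≡ suc (toℕ b)
    c≡1+b = suc-injective 1+c≡2+b

wheel-adj-≤suc : ∀ {n} (b c : Fin n) → 2 ≤ toℕ b → Adj (Wheel n) b c →
                 toℕ c ≤ suc (toℕ b)
wheel-adj-≤suc (Fin.suc Fin.zero)     _                        (s≤s ()) _
wheel-adj-≤suc (Fin.suc (Fin.suc b)) Fin.zero                 _ _ = z≤n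
wheel-adj-≤suc (Fin.suc (Fin.suc b)) (Fin.suc Fin.zero)       _ _ = s≤s z≤n
-- For b, c ≥ 2 only the disjuncts c = b + 1 and b = c + 1 of wheelAdj remain.
wheel-adj-≤suc (Fin.suc (Fin.suc b)) (Fin.suc (Fin.suc c)) _ adj
  with ∨-elim (suc (toℕ b) ≡ᵇ toℕ c) (∧-elimʳ (not (toℕ b ≡ᵇ toℕ c)) adj)
... | inj₁ c≡1+b = s≤s (s≤s (≤-reflexive (sym (≡ᵇ⇒≡ _ _ c≡1+b))))
... | inj₂ rest with ∨-elim (suc (toℕ c) ≡ᵇ toℕ b) rest
...   | inj₁ b≡1+c =
  s≤s (s≤s (m≤n⇒m≤1+n (subst (toℕ c ≤_) (≡ᵇ⇒≡ _ _ b≡1+c) (n≤1+n _))))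
...   | inj₂ ()

∣p++q∣ : ∀ {m n} (p : Subset m) (q : Subset n) → ∣ p ++ q ∣ ≡ ∣ p ∣ + ∣ q ∣
∣p++q∣ []          q = refl
∣p++q∣ (true ∷ p)  q = cong suc (∣p++q∣ p q)
∣p++q∣ (false ∷ p) q = ∣p++q∣ p q

infixr 7 _⊠_

_⊠_ : ∀ {m n} → Subset m → Subset n → Subset (m * n)
D ⊠ C = concat (map (λ d → map (d ∧_) C) D)

lookup-⊠ : ∀ {m n} (D : Subset m) (C : Subset n) g c →
           lookup (D ⊠ C) (combine g c) ≡ lookup D g ∧ lookup C c
lookup-⊠ D C g c = begin
  lookup (concat (map row D)) (combine g c) ≡⟨ lookup-concat (map row D) g c ⟩
  lookup (lookup (map row D) g) c           ≡⟨ cong (λ r → lookup r c) (lookup-map g row D) ⟩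
  lookup (map (lookup D g ∧_) C) c          ≡⟨ lookup-map c (lookup D g ∧_) C ⟩
  lookup D g ∧ lookup C c                   ∎
  where
    open ≡-Reasoning
    row : Bool → Subset _
    row d = map (d ∧_) C

module _ {m n : ℕ} {D : Subset m} {C : Subset n} where

  combine∈⊠⁺ : ∀ {g c} → g ∈ D → c ∈ C → combine g c ∈ D ⊠ C
  combine∈⊠⁺ {g} {c} g∈D c∈C = lookup⇒[]= (combine g c) (D ⊠ C)
    (trans (lookup-⊠ D C g c) (cong₂ _∧_ ([]=⇒lookup g∈D) ([]=⇒lookup c∈C)))

  combine∈⊠⁻ : ∀ {g c} → combine g c ∈ D ⊠ C → g ∈ D × c ∈ C
  combine∈⊠⁻ {g} {c} gc∈D⊠C =
    split (lookup D g) refl (trans (sym (lookup-⊠ D C g c)) ([]=⇒lookup gc∈D⊠C))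
    where
      split : ∀ d → lookup D g ≡ d → d ∧ lookup C c ≡ true → g ∈ D × c ∈ C
      split true D[g]≡true C[c]≡true =
        lookup⇒[]= g D D[g]≡true , lookup⇒[]= c C C[c]≡true

∣⊠∣ : ∀ {m n} (D : Subset m) (C : Subset n) → ∣ D ⊠ C ∣ ≡ ∣ D ∣ * ∣ C ∣
∣⊠∣ []          C = refl
∣⊠∣ (true ∷ D)  C = trans (∣p++q∣ (map (true ∧_) C) (D ⊠ C))
  (cong₂ _+_ (cong ∣_∣ (map-id C)) (∣⊠∣ D C))
∣⊠∣ {n = n} (false ∷ D) C = trans (∣p++q∣ (map (false ∧_) C) (D ⊠ C))
  (cong₂ _+_ (trans (cong ∣_∣ (map-const C false)) (∣⊥∣≡0 n)) (∣⊠∣ D C))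

walkIn-++ : ∀ {G P u v w} → WalkIn G P u v → WalkIn G P v w → WalkIn G P u w
walkIn-++ (here _)         q = q
walkIn-++ (step p u~v walk) q = step p u~v (walkIn-++ walk q)

module □-Properties (G H : Graph) where

  adj-□-combine : ∀ g b a c → adj (G □ H) (combine g b) (combine a c) ≡
                  (⌊ g Fin.≟ a ⌋ ∧ adj H b c) ∨ (⌊ b Fin.≟ c ⌋ ∧ adj G g a)
  adj-□-combine g b a c = cong₂ edge (remQuot-combine g b) (remQuot-combine a c)
    where
      edge : Fin (order G) × Fin (order H) → Fin (order G) × Fin (order H) → Bool
      edge (g , b) (a , c) = (⌊ g Fin.≟ a ⌋ ∧ adj H b c) ∨ (⌊ b Fin.≟ c ⌋ ∧ adj G g a)

  □-adj-vertical : ∀ g {b c} → Adj H b c → Adj (G □ H) (combine g b) (combine g c)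
  □-adj-vertical g {b} {c} b~c = subst T (sym (adj-□-combine g b g c))
    (∨-introˡ (⌊ g Fin.≟ g ⌋ ∧ adj H b c) (∧-intro (fromWitness refl) b~c))

  □-adj-horizontal : ∀ {g a} c → Adj G g a → Adj (G □ H) (combine g c) (combine a c)
  □-adj-horizontal {g} {a} c g~a = subst T (sym (adj-□-combine g c a c))
    (∨-introʳ (⌊ g Fin.≟ a ⌋ ∧ adj H c c) (∧-intro (fromWitness refl) g~a))

  □-adj-combine⁻ : ∀ g b a c → Adj (G □ H) (combine g b) (combine a c) →
                   (g ≡ a × Adj H b c) ⊎ (b ≡ c × Adj G g a)
  □-adj-combine⁻ g b a c adjacent
    with ∨-elim (⌊ g Fin.≟ a ⌋ ∧ adj H b c) (subst T (adj-□-combine g b a c) adjacent)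
  ... | inj₁ vertical   = inj₁ (⌊⌋∧-elim (g Fin.≟ a) vertical)
  ... | inj₂ horizontal = inj₂ (⌊⌋∧-elim (b Fin.≟ c) horizontal)

  □-ind : (P : Fin (order (G □ H)) → Set) → (∀ g c → P (combine g c)) → ∀ x → P x
  □-ind P f x = subst P (combine-remQuot {order G} (order H) x) (f (proj₁ gc) (proj₂ gc))
    where
      gc : Fin (order G) × Fin (order H)
      gc = remQuot (order H) x

  InClosedNbhd-⊠ : ∀ {D C} → IsDominating G D → ∀ g {c} → c ∈ C →
                   InClosedNbhd (G □ H) (D ⊠ C) (combine g c)
  InClosedNbhd-⊠ dominating g {c} c∈C with dominating g
  ... | inj₁ g∈D             = inj₁ (combine∈⊠⁺ g∈D c∈C)
  ... | inj₂ (d , d∈D , d~g) =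
    inj₂ (combine d c , combine∈⊠⁺ d∈D c∈C , □-adj-horizontal c d~g)

  walkIn-⊠-horizontal : ∀ {D C g a c} → c ∈ C → WalkIn G (_∈ D) g a →
                        WalkIn (G □ H) (_∈ D ⊠ C) (combine g c) (combine a c)
  walkIn-⊠-horizontal c∈C (here g∈D)          = here (combine∈⊠⁺ g∈D c∈C)
  walkIn-⊠-horizontal c∈C (step g∈D g~b walk) =
    step (combine∈⊠⁺ g∈D c∈C) (□-adj-horizontal _ g~b) (walkIn-⊠-horizontal c∈C walk)

module _ {G : Graph} {n : ℕ} {D : Subset (order G)} {C : Subset (suc n)}
         (hub∈C : Fin.zero ∈ C) where

  private
    W : Graph
    W = G □ Wheel (suc n)

    Walk : Fin (order W) → Fin (order W) → Set
    Walk = WalkIn W (_∈ D ⊠ C)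

  open □-Properties G (Wheel (suc n))

  walkIn-⊠-to-hub : ∀ {d c} → d ∈ D → c ∈ C → Walk (combine d c) (combine d Fin.zero)
  walkIn-⊠-to-hub {c = Fin.zero}  d∈D _   = here (combine∈⊠⁺ d∈D hub∈C)
  walkIn-⊠-to-hub {d} {Fin.suc c} d∈D c∈C =
    step (combine∈⊠⁺ d∈D c∈C) (□-adj-vertical d (wheel-adj-hub c))
         (here (combine∈⊠⁺ d∈D hub∈C))

  walkIn-⊠-from-hub : ∀ {d c} → d ∈ D → c ∈ C → Walk (combine d Fin.zero) (combine d c)
  walkIn-⊠-from-hub {c = Fin.zero}  d∈D _   = here (combine∈⊠⁺ d∈D hub∈C)
  walkIn-⊠-from-hub {d} {Fin.suc c} d∈D c∈C =
    step (combine∈⊠⁺ d∈D hub∈C) (□-adj-vertical d (wheel-hub-adj c))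
         (here (combine∈⊠⁺ d∈D c∈C))

  InducedConnected-⊠ : InducedConnected G D → InducedConnected W (D ⊠ C)
  InducedConnected-⊠ ((d , d∈D) , walks) =
    (combine d Fin.zero , combine∈⊠⁺ d∈D hub∈C) ,
    □-ind _ (λ g b → □-ind _ (λ a c g,b∈S a,c∈S →
      walk (combine∈⊠⁻ g,b∈S) (combine∈⊠⁻ a,c∈S)))
    where
      walk : ∀ {g b a c} → g ∈ D × b ∈ C → a ∈ D × c ∈ C → Walk (combine g b) (combine a c)
      walk {g} {a = a} (g∈D , b∈C) (a∈D , c∈C) =
        walkIn-++ (walkIn-⊠-to-hub g∈D b∈C)
          (walkIn-++ (walkIn-⊠-horizontal hub∈C (walks g a g∈D a∈D))
                     (walkIn-⊠-from-hub a∈D c∈C))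

firstThree : ∀ k → Subset (3 + k)
firstThree k = true ∷ true ∷ true ∷ ⊥

∣firstThree∣ : ∀ k → ∣ firstThree k ∣ ≡ 3
∣firstThree∣ k = cong (3 +_) (∣⊥∣≡0 k)

∈-firstThree : ∀ {k} (c : Fin (3 + k)) → toℕ c ≤ 2 → c ∈ firstThree k
∈-firstThree Fin.zero                         _ = here
∈-firstThree (Fin.suc Fin.zero)               _ = there here
∈-firstThree (Fin.suc (Fin.suc Fin.zero))     _ = there (there here)
∈-firstThree (Fin.suc (Fin.suc (Fin.suc c))) (s≤s (s≤s ()))

module _ {G : Graph} {k : ℕ} {D : Subset (order G)} (dominating : IsDominating G D) where

  private
    W : Graph
    W = G □ Wheel (3 + k)

    S : Subset (order W)
    S = D ⊠ firstThree k

  open □-Properties G (Wheel (3 + k))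

  column-forced : ∀ {b c} → toℕ c ≡ suc (toℕ b) → 2 ≤ toℕ b →
                  (∀ a c′ → toℕ c′ ≤ toℕ b → Monitored W S (combine a c′)) →
                  ∀ g → Monitored W S (combine g c)
  column-forced {b} {c} c≡1+b 2≤b below g =
    prop (below g b ≤-refl) (□-adj-vertical g (wheel-adj-suc b c c≡1+b)) (□-ind _ others)
    where
      others : ∀ a c′ → Adj W (combine g b) (combine a c′) → combine a c′ ≢ combine g c →
               Monitored W S (combine a c′)
      others a c′ adjacent a,c′≢g,c with □-adj-combine⁻ g b a c′ adjacent
      ... | inj₂ (refl , _)     = below a b ≤-refl
      ... | inj₁ (refl , b~c′) =
        below g c′ (m<1+n⇒m≤n (≤∧≢⇒< (wheel-adj-≤suc b c′ 2≤b b~c′) c′≢1+b))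
        where
          c′≢1+b : toℕ c′ ≢ suc (toℕ b)
          c′≢1+b c′≡1+b =
            a,c′≢g,c (cong (combine g) (toℕ-injective (trans c′≡1+b (sym c≡1+b))))

  columns-forced : ∀ {j} → 2 ≤ j → (∀ g c → toℕ c ≤ j → Monitored W S (combine g c)) →
                   ∀ g c → toℕ c ≤ suc j → Monitored W S (combine g c)
  columns-forced {j} 2≤j below g c c≤1+j with toℕ c ≤? j
  ... | yes c≤j = below g c c≤j
  ... | no  c≰j = column-forced {b} c≡1+b (subst (2 ≤_) (sym b≡j) 2≤j)
                    (λ a c′ c′≤b → below a c′ (subst (toℕ c′ ≤_) b≡j c′≤b)) g
    where
      c≡1+j : toℕ c ≡ suc j
      c≡1+j = ≤-antisym c≤1+j (≰⇒> c≰j)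
      b : Fin (3 + k)
      b = fromℕ< (<⇒≤ (subst (_< 3 + k) c≡1+j (toℕ<n c)))
      b≡j : toℕ b ≡ j
      b≡j = toℕ-fromℕ< _
      c≡1+b : toℕ c ≡ suc (toℕ b)
      c≡1+b = trans c≡1+j (cong suc (sym b≡j))

  monitored-upTo : ∀ t g c → toℕ c ≤ 2 + t → Monitored W S (combine g c)
  monitored-upTo zero    g c c≤2 = dom (InClosedNbhd-⊠ dominating g (∈-firstThree c c≤2))
  monitored-upTo (suc t) = columns-forced (s≤s (s≤s z≤n)) (monitored-upTo t)

  IsPowerDominating-⊠-firstThree : IsPowerDominating W S
  IsPowerDominating-⊠-firstThree =
    □-ind _ (λ g c → monitored-upTo k g c (m<1+n⇒m≤n (toℕ<n c)))

corollary4 : (n : ℕ) → 4 ≤ n → (G : Graph) → IsSimple G → IsConnected G → 3 ≤ order G →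
    (D : Subset (order G)) → IsConnectedDominating G D →
    Σ (Subset (order (G □ Wheel n))) (λ S →
    IsConnectedPowerDominating (G □ Wheel n) S × ∣ S ∣ ≤ 3 * ∣ D ∣)
corollary4 (suc (suc (suc k))) (s≤s (s≤s (s≤s _))) G _ _ _ D (dominating , connected) =
  D ⊠ firstThree k ,
  (IsPowerDominating-⊠-firstThree dominating , InducedConnected-⊠ here connected) ,
  ≤-reflexive size
  where
    open ≡-Reasoning
    size : ∣ D ⊠ firstThree k ∣ ≡ 3 * ∣ D ∣
    size = begin
      ∣ D ⊠ firstThree k ∣          ≡⟨ ∣⊠∣ D (firstThree k) ⟩
      ∣ D ∣ * ∣ firstThree k ∣      ≡⟨ cong (∣ D ∣ *_) (∣firstThree∣ k) ⟩
      ∣ D ∣ * 3                     ≡⟨ *-comm ∣ D ∣ 3 ⟩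
      3 * ∣ D ∣                     ∎
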